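{- Let $M$ and $M'$ be reachable markings of a t-net, and let $R\in\mathit{repr}(M)$, $R'\in\mathit{repr}(M')$. If $R\sim_h R'$, then: (1) the restriction of $h$ to $\mathit{pid}_M$ is a bijection $\mathit{pid}_M\to\mathit{pid}_{M'}$; (2) the restriction of $h$ to $\mathit{nextpid}_M$ is a bijection $\mathit{nextpid}_M\to\mathit{nextpid}_{M'}$; (3) the restriction of $h$ to $\mathit{pid}_M\cup\mathit{nextpid}_M$ is a bijection $\mathit{pid}_M\cup\mathit{nextpid}_M\to\mathit{pid}_{M'}\cup\mathit{nextpid}_{M'}$.
   Context: Process identifiers (pids). $\mathbb{P}=(\mathbb{N}^+)^*$ is the set of finite tuples of positive integers, including the empty tuple $\langle\rangle$; monoid under concatenation; $\langle a_1,\dots,a_n\rangle$ is written $a_1.\cdots.a_n$. For $\pi=\langle a_1,\dots,a_n\rangle$: $\mathit{length}(\pi)=n$; $\mathit{prefix}(\pi)=\langle a_1,\dots,a_{n-1}\rangle$ if $n>0$, else $\langle\rangle$; $\mathit{subpid}(\pi)=\{\pi\}\cup\mathit{subpid}(\mathit{prefix}(\pi))$ if $n>0$, $\emptyset$ if $n=0$. $\mathbb P$ is totally ordered hierarchically: by length, then lexicographically. Coloured Petri nets and t-nets. Fix data values $\mathbb D\supseteq\mathbb N$ (disjoint from $\mathbb P$), variables $\mathbb V$, expressions $\mathbb E\supseteq\mathbb V\cup\mathbb D$ (including Boolean ones); a binding is a partial map $\beta:\mathbb V\to\mathbb P\cup\mathbb D$, extended to expressions and multisets of them. A Petri net $(S,T,\ell)$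 has finite disjoint places $S$ and transitions $T$, place types $\ell(s)=X_1\times\dots\times X_k$ ($X_i\in\{\mathbb P,\mathbb D\}$), guards $\ell(t)\in\mathbb E$, arc labels $\ell(x,y)$ multisets over $\mathbb E$. A marking maps each place to a multiset of tokens of its type. $M\xrightarrow{t,\beta}M'$ iff $M(s)\ge\beta(\ell(s,t))$, $\beta(\ell(t,s))$ has type $\ell(s)$, $M'(s)=M(s)-\beta(\ell(s,t))+\beta(\ell(t,s))$ for all $s$, and $\beta(\ell(t))$ is true. A t-net additionally has: a unique generator place $s_\eta$ of type $\mathbb P\times\mathbb N$; initial marking $M_0$ with $M_0(s_\eta)=\{\langle\langle1\rangle,0\rangle\}$ and other places empty or containing only data; for each $t$, $\ell(s_\eta,t)=\{\langle p_i,c_i\rangle:1\le i\le k\}$ (distinct variables) and $\ell(t,s_\eta)=\{\langle p_i,c_i+n_i\rangle:1\le i\le m\}\cup\{\langle p_i.(c_i+j),0\rangle:1\le i\le k,1\le j\le n_i\}$ ($m\le k$, $n_i\ge0$), with $\Pi_t$ the set of the $p_i.(c_i+j)$; arcs from places $s\ne s_\eta$ carry vectors of variables and data values, arcs to $s\ne s_\eta$ carry vectors of expressions over data variables/values and elements of $\Pi_t\cup\{p_1,\dots,p_m\}$; guards are computable Boolean expressions in which pids are only compared with $=$, $\sphericalangle_1$ (parent), $\sphericalangle$ (ancestor), $\pitchfork_1$, $\pitchfork$ (sibling relations). Reachable markings are those obtained from $M_0$ by finitely many firings. States. For reachable $M$: $\eta_M=\{\pi\mapsto k:\langle\pi,k\rangle\in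 M(s_\eta)\}$; $\mathit{next}_M(\pi)=\pi.(\eta_M(\pi)+1)$ for $\pi\in\mathrm{dom}(\eta_M)$; $\mathit{nextpid}_M=\{\mathit{next}_M(\pi):\pi\in\mathrm{dom}(\eta_M)\}$; $\mathit{pid}_M$ is the set of pids occurring in tokens of $M$ in any place (including $s_\eta$). Pid-trees. $\Xi$ is the least set with $\langle M,C\rangle\in\Xi$ for a marking $M$ and $C=\langle\langle a_1,t_1\rangle,\dots,\langle a_n,t_n\rangle\rangle$, $t_i\in\Xi$, $a_i\in\mathbb P\setminus\{\langle\rangle\}$, and for $i\ne j$: $a_i\ne a_j$, $a_i\notin\mathit{subpid}(a_j)$, $a_j\notin\mathit{subpid}(a_i)$; written $M\xrightarrow{a_1,\dots,a_n}\langle t_1,\dots,t_n\rangle$, with root marking $M_t=M$. Inclusion: $\langle M',\langle\langle a'_i,t'_i\rangle\rangle_{i\le m}\rangle\subseteq\langle M,\langle\langle a_j,t_j\rangle\rangle_{j\le n}\rangle$ iff $M'\le M$ and each $i$ has a $j$ with $a'_i=a_j$, $t'_i\subseteq t_j$. Subtrees: $\langle\langle\rangle,t_0\rangle\in\mathit{Trees}(t_0)$, and $\langle a_i.\pi',t\rangle\in\mathit{Trees}(t_0)$ if $\langle\pi',t\rangle\in\mathit{Trees}(t_i)$. $\mathit{pid}(t)=\{\pi:\langle\pi,t'\rangle\in\mathit{Trees}(t)\}$. A path labelled $\pi$ decorated by $M'$ is a pid-tree $t$ with $\pi\in\mathit{pid}(t)\subseteq\mathit{subpid}(\pi)\cup\{\langle\rangle\}$,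 $\langle\pi,\langle M',\langle\rangle\rangle\rangle\in\mathit{Trees}(t)$, all other node markings empty; "$R$ contains $\mathit{path}(\pi,M')$" means some such path is $\subseteq R$; $\mathit{path}(\pi)=\mathit{path}(\pi,\emptyset)$. Relative path of a nonempty $\pi\in\mathit{pid}(t)$, $t=M\xrightarrow{a_1,\dots,a_n}\langle t_1,\dots,t_n\rangle$: $\mathit{relpath}(\pi,t)=\langle i\rangle$ if $\pi=a_i$, and $\langle i\rangle$ concatenated with $\mathit{relpath}(\pi',t_i)$ if $\pi=a_i.\pi'$, $\pi'\ne\langle\rangle$; by convention $\mathit{relpath}(\langle\rangle,t)=\langle\rangle$. A pid-tree is sibling ordered if at every node $a_1\le\dots\le a_n$ in the hierarchical order. Representations. $\mathit{repr}(M)$ is the set of sibling ordered pid-trees $R$ built so that for each place $s$ of type $X_1\times\dots\times X_n$ and each token $v=\langle x_1,\dots,x_n\rangle\in M(s)$ exactly one rule applies, and $R$ contains nothing beyond what the rules require (tokens with multiplicity): generator rule ($s=s_\eta$, $v=\langle\pi,i\rangle$): $R$ contains $\mathit{path}(\pi)$ and $\mathit{path}(\pi.(i+1))$; shared rule ($X_1=\mathbb D$): $R$ contains $\mathit{path}(\langle\rangle,\{(s,v)\})$ and $\mathit{path}(x_i)$ for every $X_i=\mathbb P$; owned rule ($X_1=\mathbb P$): $R$ contains $\mathit{path}(x_1,\{(s,v)\})$ and $\mathit{path}(x_i)$ for every $X_i=\mathbb P$. Equivalence of sibling ordered pid-trees. $T\sim_h T'$ iff (1) $h=\{(\pi,\pi'):\pi\in\mathit{pid}(T),\pi'\in\mathit{pid}(T'),\mathit{relpath}(\pi,T)=\mathit{relpath}(\pi',T')\}$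 is a bijection $\mathit{pid}(T)\to\mathit{pid}(T')$; and (2) for all $\langle\pi,t\rangle\in\mathit{Trees}(T)$, $\langle h(\pi),t'\rangle\in\mathit{Trees}(T')$ with $t=M_t\xrightarrow{a_1,\dots,a_n}\langle t_1,\dots,t_n\rangle$, $t'=M_{t'}\xrightarrow{a'_1,\dots,a'_{n'}}\langle t'_1,\dots,t'_{n'}\rangle$: (a) $n=n'$; (b) for each place $s\ne s_\eta$, $M_{t'}(s)$ is $M_t(s)$ with every pid $\rho$ in its tuples replaced by $h(\rho)$; (c) for each $i$, either $\mathit{length}(a_i)=\mathit{length}(a'_i)=1$ or both lengths are $>1$; (d) for each $1\le i<n$ with $\mathit{prefix}(a_i)=\mathit{prefix}(a_{i+1})$, also $\mathit{prefix}(a'_i)=\mathit{prefix}(a'_{i+1})$ and, writing $x,y,x',y'$ for the last components of $a_i,a_{i+1},a'_i,a'_{i+1}$, either $y-x=y'-x'=1$ or both $y-x>1$ and $y'-x'>1$. -}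

module Defs where

open import Data.Nat using (ℕ; zero; suc; _+_; _∸_; _<_; _≤_; _>_; _≡ᵇ_; _<ᵇ_)
import Data.Nat as ℕ
open import Data.Bool using (Bool; true; false; _∧_; not)
open import Data.List using (List; []; _∷_; _++_; [_]; map; concatMap; length; filter; allFin)
open import Data.List.Properties using (≡-dec)
open import Data.List.Membership.Propositional using (_∈_)
open import Data.List.Relation.Unary.All using (All)
open import Data.List.Relation.Unary.Any using (Any)
open import Data.List.Relation.Unary.AllPairs using (AllPairs)
open import Data.List.Relation.Unary.Linked using (Linked)
open import Data.List.Relation.Binary.Permutation.Propositional using (_↭_)
open import Data.List.Relation.Binary.Pointwise using (Pointwise)
open import Data.Fin using (Fin; toℕ; inject≤)
import Data.Fin as Fin
open import Data.Maybe using (Maybe; just; nothing)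
open import Data.Product using (Σ; ∃; ∃-syntax; _×_; _,_; proj₁; proj₂)
open import Data.Sum using (_⊎_; inj₁; inj₂)
open import Data.Unit using (⊤)
open import Data.Empty using (⊥)
open import Relation.Nullary using (¬_; does; yes; no)
open import Relation.Binary.PropositionalEquality using (_≡_; _≢_; refl)
open import Relation.Binary.Definitions using (DecidableEquality)

-- A pid is a finite tuple of naturals; the
-- numbers are used literally (component 1 means 1).  All pids arising
-- from the net semantics (starting from ⟨1⟩ and appending c+j, j ≥ 1)
-- have positive components.

Pid : Set
Pid = List ℕ

_≟ₚ_ : DecidableEquality Pid
_≟ₚ_ = ≡-dec ℕ._≟_

prefix : Pid → Pid
prefix []          = []
prefix (x ∷ [])    = []
prefix (x ∷ y ∷ r) = x ∷ prefix (y ∷ r)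

-- last component (only used on nonempty pids)
lastC : Pid → ℕ
lastC []          = 0
lastC (x ∷ [])    = x
lastC (x ∷ y ∷ r) = lastC (y ∷ r)

data _∈subpid_ : Pid → Pid → Set where
  self : ∀ {ρ} → ρ ≢ [] → ρ ∈subpid ρ
  up   : ∀ {π ρ} → ρ ≢ [] → π ∈subpid prefix ρ → π ∈subpid ρ

LexLe : Pid → Pid → Set
LexLe []       _        = ⊤
LexLe (x ∷ xs) []       = ⊥
LexLe (x ∷ xs) (y ∷ ys) = x < y ⊎ (x ≡ y × LexLe xs ys)

_≤ₕ_ : Pid → Pid → Set
a ≤ₕ b = length a < length b ⊎ (length a ≡ length b × LexLe a b)

-- The pid relations usable in guards: =, ⋖₁ (parent), ⋖ (ancestor),
-- ⋔₁ (immediate elder sibling), ⋔ (elder sibling).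

data PidRel : Set where
  eqR parentR ancestorR sib1R sibR : PidRel

nonEmptyB : Pid → Bool
nonEmptyB []      = false
nonEmptyB (_ ∷ _) = true

isPrefixB : Pid → Pid → Bool
isPrefixB []       _        = true
isPrefixB (x ∷ xs) []       = false
isPrefixB (x ∷ xs) (y ∷ ys) = (x ≡ᵇ y) ∧ isPrefixB xs ys

relB : PidRel → Pid → Pid → Bool
relB eqR       π π' = does (π ≟ₚ π')
relB parentR   π π' = nonEmptyB π' ∧ does (π ≟ₚ prefix π')
relB ancestorR π π' = nonEmptyB π ∧ (isPrefixB π π' ∧ (length π <ᵇ length π'))
relB sib1R     π π' = nonEmptyB π ∧ (nonEmptyB π' ∧ (does (prefix π ≟ₚ prefix π')
                        ∧ (suc (lastC π) ≡ᵇ lastC π')))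
relB sibR      π π' = nonEmptyB π ∧ (nonEmptyB π' ∧ (does (prefix π ≟ₚ prefix π')
                        ∧ (lastC π <ᵇ lastC π')))

-- Data values 𝔻 ⊇ ℕ (disjointness from ℙ is by typing)

record DataDom : Set₁ where
  field
    D           : Set
    ι           : ℕ → D
    ι-injective : ∀ {a b} → ι a ≡ ι b → a ≡ b

-- the two components of place types: ℙ or 𝔻
data Sort : Set where
  P Dt : Sort

TupF : (Sort → Set) → List Sort → Set
TupF F []       = ⊤
TupF F (x ∷ xs) = F x × TupF F xs

module _ (Dd : DataDom) where
  open DataDom Dd

  Val : Sort → Set
  Val P  = Pid
  Val Dt = D

  Tup : List Sort → Set
  Tup = TupF Val

  pidsOf : (xs : List Sort) → Tup xs → List Pid
  pidsOf []        _        = []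
  pidsOf (P ∷ xs)  (π , v)  = π ∷ pidsOf xs v
  pidsOf (Dt ∷ xs) (_ , v)  = pidsOf xs v

  -- Transitions of a t-net (variables are typed)
  --   pid variables : p_1..p_k (Fin k) and further pid variables (Fin nPV)
  --   data variables: c_1..c_k (Fin k, values in ℕ ⊆ 𝔻) and further
  --                   data variables (Fin nDV)

  data DIn (k nDV : ℕ) : Set where
    dvar   : Fin nDV → DIn k nDV
    cvar   : Fin k → DIn k nDV
    dconst : D → DIn k nDV

  -- input slot (arcs from s ≠ s_η): variables and data values
  InSlot : (k nPV nDV : ℕ) → Sort → Set
  InSlot k nPV nDV P  = Fin k ⊎ Fin nPV
  InSlot k nPV nDV Dt = DIn k nDV

  -- pid output expressions: p_i (i ≤ m) or p_i.(c_i + j), 1 ≤ j ≤ n_i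
  data OutPid (k m : ℕ) (nOut : Fin k → ℕ) : Set where
    keep : Fin m → OutPid k m nOut
    new  : (i : Fin k) → Fin (nOut i) → OutPid k m nOut

  -- output slot (arcs to s ≠ s_η): data expressions (computable
  -- functions of the data variables) or elements of Π_t ∪ {p_1..p_m}
  OutSlot : (k m : ℕ) (nOut : Fin k → ℕ) (nDV : ℕ) → Sort → Set
  OutSlot k m nOut nDV P  = OutPid k m nOut
  OutSlot k m nOut nDV Dt = (Fin nDV → D) → (Fin k → ℕ) → D

  record Trans (nS : ℕ) (typ : Fin nS → List Sort) : Set where
    field
      k     : ℕ
      m     : ℕ
      m≤k   : m ≤ k
      nOut  : Fin k → ℕ
      nPV   : ℕ
      nDV   : ℕ
      inArc  : (s : Fin nS) → List (TupF (InSlot k nPV nDV) (typ s))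
      outArc : (s : Fin nS) → List (TupF (OutSlot k m nOut nDV) (typ s))
      guard : (Fin nDV → D) → (Fin k → ℕ)
              → (Fin k ⊎ Fin nPV → Fin k ⊎ Fin nPV → PidRel → Bool) → Bool

  -- t-nets.  Places S = Fin nS (the non-generator places); the
  -- generator place s_η is treated separately.  Place s has type
  -- hd s × tl s (at least one component).

  record TNet : Set where
    field
      nS    : ℕ
      hd    : Fin nS → Sort
      tl    : Fin nS → List Sort
      nT    : ℕ
      trans : Fin nT → Trans nS (λ s → hd s ∷ tl s)
      init  : (s : Fin nS) → List (Tup (hd s ∷ tl s))
      init-data : ∀ s → All (λ v → pidsOf (hd s ∷ tl s) v ≡ []) (init s)

module _ {Dd : DataDom} (N : TNet Dd) where
  open DataDom Dd
  open TNet N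

  typ : Fin nS → List Sort
  typ s = hd s ∷ tl s

  Tok : Fin nS → Set
  Tok s = Tup Dd (typ s)

  PMark : Set
  PMark = (s : Fin nS) → List (Tok s)

  record Marking : Set where
    constructor mk
    field
      gen : List (Pid × ℕ)
      pl  : PMark
  open Marking public

  M₀ : Marking
  M₀ = mk (((1 ∷ []) , 0) ∷ []) init

  _≈M_ : Marking → Marking → Set
  M ≈M M' = (gen M ↭ gen M') × (∀ s → pl M s ↭ pl M' s)

  module _ (t : Fin nT) where
    open Trans (trans t)

    PVar : Set
    PVar = Fin k ⊎ Fin nPV

    record Binding : Set where
      field
        bp : PVar → Pid
        bc : Fin k → ℕ
        bd : Fin nDV → D
    open Binding

    evIn : (β : Binding) (xs : List Sort) → TupF (InSlot Dd k nPV nDV) xs → Tup Dd xs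
    evIn β []        _               = _
    evIn β (P ∷ xs)  (x , r)         = bp β x , evIn β xs r
    evIn β (Dt ∷ xs) (dvar x , r)    = bd β x , evIn β xs r
    evIn β (Dt ∷ xs) (cvar i , r)    = ι (bc β i) , evIn β xs r
    evIn β (Dt ∷ xs) (dconst d , r)  = d , evIn β xs r

    evPid : Binding → OutPid Dd k m nOut → Pid
    evPid β (keep i)  = bp β (inj₁ (inject≤ i m≤k))
    evPid β (new i j) = bp β (inj₁ i) ++ [ bc β i + suc (toℕ j) ]

    evOut : (β : Binding) (xs : List Sort) → TupF (OutSlot Dd k m nOut nDV) xs → Tup Dd xs
    evOut β []        _       = _
    evOut β (P ∷ xs)  (e , r) = evPid β e , evOut β xs r
    evOut β (Dt ∷ xs) (e , r) = e (bd β) (bc β) , evOut β xs r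

    genIn : Binding → List (Pid × ℕ)
    genIn β = map (λ i → bp β (inj₁ i) , bc β i) (allFin k)

    genOut : Binding → List (Pid × ℕ)
    genOut β =
      map (λ i → bp β (inj₁ (inject≤ i m≤k)) , bc β (inject≤ i m≤k) + nOut (inject≤ i m≤k))
          (allFin m)
      ++ concatMap (λ i → map (λ j → (bp β (inj₁ i) ++ [ bc β i + suc (toℕ j) ]) , 0)
                              (allFin (nOut i)))
                   (allFin k)

    guardTrue : Binding → Set
    guardTrue β = guard (bd β) (bc β) (λ x y r → relB r (bp β x) (bp β y)) ≡ true

    Fires : Marking → Binding → Marking → Set
    Fires M β M' =
      (∃ λ (rest : List (Pid × ℕ)) → (gen M ↭ genIn β ++ rest) × (gen M' ↭ genOut β ++ rest))
      × (∀ s → ∃ λ (rest : List (Tok s)) →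
                 (pl M s ↭ map (evIn β (typ s)) (inArc s) ++ rest)
               × (pl M' s ↭ map (evOut β (typ s)) (outArc s) ++ rest))
      × guardTrue β

  data Reachable : Marking → Set where
    initial : ∀ {M} → M ≈M M₀ → Reachable M
    step    : ∀ {M M'} (t : Fin nT) (β : Binding t) →
              Reachable M → Fires t M β M' → Reachable M'

  pidM : Marking → Pid → Set
  pidM M ρ = (∃[ i ] ((ρ , i) ∈ gen M))
           ⊎ (∃[ s ] ∃[ v ] (v ∈ pl M s × ρ ∈ pidsOf Dd (typ s) v))

  nextpid : Marking → Pid → Set
  nextpid M ρ = ∃[ π ] ∃[ i ] ((π , i) ∈ gen M × ρ ≡ π ++ [ suc i ])

  data Tree : Set where
    node : PMark → List (Pid × Tree) → Tree

  mark : Tree → PMark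
  mark (node M _) = M

  children : Tree → List (Pid × Tree)
  children (node _ cs) = cs

  labels : List (Pid × Tree) → List Pid
  labels = map proj₁

  Compatible : Pid → Pid → Set
  Compatible a b = a ≢ b × ¬ (a ∈subpid b) × ¬ (b ∈subpid a)

  data IsPidTree : Tree → Set where
    ptree : ∀ {M cs} → All (λ c → proj₁ c ≢ []) cs → AllPairs Compatible (labels cs)
            → All (λ c → IsPidTree (proj₂ c)) cs → IsPidTree (node M cs)

  data SiblingOrdered : Tree → Set where
    sord : ∀ {M cs} → Linked _≤ₕ_ (labels cs)
           → All (λ c → SiblingOrdered (proj₂ c)) cs → SiblingOrdered (node M cs)

  data SubAt : Tree → Pid → Tree → Set where
    here  : ∀ {t} → SubAt t [] t
    there : ∀ {t a ti π' u π} → (a , ti) ∈ children t → SubAt ti π' u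
            → π ≡ a ++ π' → SubAt t π u

  pidT : Tree → Pid → Set
  pidT t π = ∃[ u ] SubAt t π u

  _≤M_ : PMark → PMark → Set
  M' ≤M M = ∀ s → ∃ λ (rest : List (Tok s)) → (M s ↭ M' s ++ rest)

  data _⊆T_ : Tree → Tree → Set where
    incl : ∀ {M' cs' M cs} → M' ≤M M
           → All (λ c' → Any (λ c → proj₁ c' ≡ proj₁ c × proj₂ c' ⊆T proj₂ c) cs) cs'
           → node M' cs' ⊆T node M cs

  emptyM : PMark
  emptyM _ = []

  singleM : (s : Fin nS) → Tok s → PMark
  singleM s v s' with s Fin.≟ s'
  ... | yes refl = v ∷ []
  ... | no _     = []

  IsPath : Pid → PMark → Tree → Set
  IsPath π M' t =
      IsPidTree t
    × SubAt t π (node M' [])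
    × (∀ ρ u → SubAt t ρ u → ρ ≡ [] ⊎ ρ ∈subpid π)
    × (∀ ρ u → SubAt t ρ u → ρ ≢ π → ∀ s → mark u s ≡ [])

  ContainsPath : Tree → Pid → PMark → Set
  ContainsPath R π M' = ∃ λ (t : Tree) → IsPath π M' t × t ⊆T R

  -- the node a token of place s is attached to: x_1 (owned) or ⟨⟩ (shared)
  ownerV : (x : Sort) → Val Dd x → Pid
  ownerV P  π = π
  ownerV Dt _ = []

  owner : (s : Fin nS) → Tok s → Pid
  owner s v = ownerV (hd s) (proj₁ v)

  ownedAt : Marking → Pid → PMark
  ownedAt M π s = filter (λ v → owner s v ≟ₚ π) (pl M s)

  Repr : Marking → Tree → Set
  Repr M R =
      IsPidTree R
    × SiblingOrdered R
    × (∀ π i → (π , i) ∈ gen M →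
         ContainsPath R π emptyM × ContainsPath R (π ++ [ suc i ]) emptyM)
    × (∀ s v → v ∈ pl M s →
         ContainsPath R (owner s v) (singleM s v)
       × All (λ ρ → ContainsPath R ρ emptyM) (pidsOf Dd (typ s) v))
    × (∀ π u → SubAt R π u →
         π ≡ [] ⊎ ∃[ ρ ] ((pidM M ρ ⊎ nextpid M ρ) × π ∈subpid ρ))
    × (∀ π u → SubAt R π u → ∀ s → mark u s ↭ ownedAt M π s)

  nth : {A : Set} → List A → ℕ → Maybe A
  nth []       _       = nothing
  nth (x ∷ xs) zero    = just x
  nth (x ∷ xs) (suc i) = nth xs i

  -- relpath(π,t) ≡ r  (children indexed from 0)
  data RelPath : Tree → Pid → List ℕ → Set where
    root  : ∀ {t} → RelPath t [] []
    child : ∀ {t i a ti π' r π} → nth (children t) i ≡ just (a , ti)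
            → RelPath ti π' r → π ≡ a ++ π' → RelPath t π (i ∷ r)

  hRel : Tree → Tree → Pid → Pid → Set
  hRel T T' π π' = pidT T π × pidT T' π' × ∃[ r ] (RelPath T π r × RelPath T' π' r)

  restrict : (Pid → Pid → Set) → (Pid → Set) → Pid → Pid → Set
  restrict h A π π' = A π × h π π'

  IsBijection : (Pid → Pid → Set) → (Pid → Set) → (Pid → Set) → Set
  IsBijection h A B =
      (∀ x y → h x y → A x × B y)
    × (∀ x → A x → ∃[ y ] h x y)
    × (∀ x y y' → h x y → h x y' → y ≡ y')
    × (∀ x x' y → h x y → h x' y → x ≡ x')
    × (∀ y → B y → ∃[ x ] h x y)

  TupRel : (Pid → Pid → Set) → (xs : List Sort) → Tup Dd xs → Tup Dd xs → Set
  TupRel h []        _       _         = ⊤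
  TupRel h (P ∷ xs)  (π , v) (π' , v') = h π π' × TupRel h xs v v'
  TupRel h (Dt ∷ xs) (d , v) (d' , v') = d ≡ d' × TupRel h xs v v'

  LenSim : Pid → Pid → Set
  LenSim a a' = (length a ≡ 1 × length a' ≡ 1) ⊎ (length a > 1 × length a' > 1)

  DiffSim : ℕ → ℕ → ℕ → ℕ → Set
  DiffSim x y x' y' = (y ∸ x ≡ 1 × y' ∸ x' ≡ 1) ⊎ (y ∸ x > 1 × y' ∸ x' > 1)

  ConsSim : Pid → List Pid → Pid → List Pid → Set
  ConsSim a (b ∷ _) a' (b' ∷ _) =
    prefix a ≡ prefix b → prefix a' ≡ prefix b' × DiffSim (lastC a) (lastC b) (lastC a') (lastC b')
  ConsSim _ _ _ _ = ⊤

  LabSim : List Pid → List Pid → Set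
  LabSim []       []         = ⊤
  LabSim (a ∷ as) (a' ∷ as') = LenSim a a' × ConsSim a as a' as' × LabSim as as'
  LabSim _        _          = ⊥

  NodeSim : (Pid → Pid → Set) → Tree → Tree → Set
  NodeSim h (node M cs) (node M' cs') =
      length cs ≡ length cs'
    × (∀ s → ∃ λ (ys : List (Tok s)) → Pointwise (TupRel h (typ s)) (M s) ys × (M' s ↭ ys))
    × LabSim (labels cs) (labels cs')

  Equiv : Tree → Tree → Set
  Equiv T T' =
      IsBijection (hRel T T') (pidT T) (pidT T')
    × (∀ π π' u u' → SubAt T π u → SubAt T' π' u' → hRel T T' π π' → NodeSim (hRel T T') u u')

module Submission where

-- Idea.  Since h is already a bijection pid(R) → pid(R'), it suffices to
-- show that h maps pid_M into pid_M' and back (likewise for nextpid).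
-- We characterise the three kinds of pids of M by features of R that
-- the conditions of ∼_h visibly preserve:
--   * pids occurring in tokens of places   = pids Referenced by a token
--     stored in some node marking of R;
--   * nextpid_M                            = FreshLeaf addresses: childless
--     nodes with empty marking that no token refers to;
--   * pids of the generator place (dom η_M) = FreshParent addresses: nodes
--     with a child that is a fresh leaf.
-- The characterisation needs one invariant of reachable markings (Fresh):
-- every pid used by M below a generator entry ⟨π,i⟩ lies below a child
-- π.j with j ≤ i, so next_M(π) and its subtree are unused.

open import Defs
open import Data.Nat using (ℕ; zero; suc; _+_; _≤_)
open import Data.Nat.Properties
  using (≤-trans; m≤m+n; +-monoʳ-≤; +-cancelˡ-≡; suc-injective; 1+n≰n; m+1+n≰m)
open import Data.Fin using (Fin; toℕ; inject≤)
open import Data.Fin.Properties using (toℕ-injective; inject≤-injective; toℕ<n)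
open import Data.List using (List; []; _∷_; _++_; [_]; map; length; concatMap; allFin)
open import Data.List.Properties
  using (++-assoc; ++-identityʳ; ++-identityʳ-unique; ++-conicalˡ; ++-conicalʳ; ++-cancelˡ;
         ∷-injective; ∷ʳ-injective)
open import Data.List.Membership.Propositional using (_∈_; find)
open import Data.List.Membership.Propositional.Properties
  using (∈-map⁺; ∈-map⁻; ∈-++⁺ˡ; ∈-++⁺ʳ; ∈-++⁻; ∈-concatMap⁻; ∈-allFin; ∈-filter⁺; ∈-filter⁻)
open import Data.List.Relation.Unary.All as All using (All; []; _∷_)
import Data.List.Relation.Unary.All.Properties as AllP
open import Data.List.Relation.Unary.Any using (Any; here; there)
open import Data.List.Relation.Unary.AllPairs using (AllPairs; []; _∷_)
import Data.List.Relation.Unary.AllPairs.Properties as AllPairsP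
open import Data.List.Relation.Binary.Pointwise using (Pointwise; []; _∷_)
open import Data.List.Relation.Binary.Permutation.Propositional using (_↭_; ↭-sym; ↭⇒↭ₛ)
open import Data.List.Relation.Binary.Permutation.Propositional.Properties using (∈-resp-↭)
import Data.List.Relation.Binary.Permutation.Setoid.Properties as PermSetoid
open import Data.Maybe using (just)
open import Data.Product using (∃; _×_; _,_; proj₁; proj₂)
open import Data.Sum using (_⊎_; inj₁; inj₂; [_,_]′) renaming (map to ⊎-map)
open import Function using (id)
open import Data.Empty using (⊥; ⊥-elim)
open import Relation.Nullary using (¬_)
open import Relation.Binary.PropositionalEquality
  using (_≡_; _≢_; refl; sym; trans; cong; subst; setoid)

++-split : {A : Set} (a X b Y : List A) → a ++ X ≡ b ++ Y →
           (∃ λ e → b ≡ a ++ e × X ≡ e ++ Y) ⊎ (∃ λ e → a ≡ b ++ e × Y ≡ e ++ X)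
++-split []      X b       Y eq = inj₁ (b , refl , eq)
++-split (x ∷ a) X []      Y eq = inj₂ (x ∷ a , refl , sym eq)
++-split (x ∷ a) X (y ∷ b) Y eq with ∷-injective eq
... | refl , eq′ with ++-split a X b Y eq′
...   | inj₁ (e , p , q) = inj₁ (e , cong (x ∷_) p , q)
...   | inj₂ (e , p , q) = inj₂ (e , cong (x ∷_) p , q)

no-members⇒[] : {A : Set} {xs : List A} → (∀ {x} → x ∈ xs → ⊥) → xs ≡ []
no-members⇒[] {xs = []}    _    = refl
no-members⇒[] {xs = x ∷ _} none = ⊥-elim (none (here refl))

∈-[] : {A : Set} {xs : List A} {x : A} → xs ≡ [] → x ∈ xs → ⊥
∈-[] refl ()

¬≢[]⇒≡[] : {A : Set} (xs : List A) → ¬ (xs ≢ []) → xs ≡ []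
¬≢[]⇒≡[] []      _   = refl
¬≢[]⇒≡[] (x ∷ _) ¬≢ = ⊥-elim (¬≢ (λ ()))

AllPairs-pick : {A : Set} {R : A → A → Set} {xs : List A} {x y : A} →
                AllPairs R xs → x ∈ xs → y ∈ xs → x ≡ y ⊎ R x y ⊎ R y x
AllPairs-pick (_ ∷ _)  (here refl) (here refl) = inj₁ refl
AllPairs-pick (rs ∷ _) (here refl) (there y∈)  = inj₂ (inj₁ (All.lookup rs y∈))
AllPairs-pick (rs ∷ _) (there x∈)  (here refl) = inj₂ (inj₂ (All.lookup rs x∈))
AllPairs-pick (_ ∷ ps) (there x∈)  (there y∈)  = AllPairs-pick ps x∈ y∈

AllPairs-resp-↭ : {A : Set} {R : A → A → Set} → (∀ {x y} → R x y → R y x) →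
                  {xs ys : List A} → xs ↭ ys → AllPairs R xs → AllPairs R ys
AllPairs-resp-↭ {A} R-sym xs↭ys =
  PermSetoid.AllPairs-resp-↭ (setoid A) R-sym ((λ { refl r → r }) , (λ { refl r → r })) (↭⇒↭ₛ xs↭ys)

AllPairs-++⁻ : {A : Set} {R : A → A → Set} (xs : List A) {ys : List A} → AllPairs R (xs ++ ys) →
               AllPairs R xs × AllPairs R ys × All (λ x → All (R x) ys) xs
AllPairs-++⁻ []       ps       = [] , ps , []
AllPairs-++⁻ (x ∷ xs) (rs ∷ ps) with AllPairs-++⁻ xs ps
... | pxs , pys , cross = (AllP.++⁻ˡ xs rs ∷ pxs) , pys , (AllP.++⁻ʳ xs rs ∷ cross)

Pointwise-∈ˡ : {A B : Set} {R : A → B → Set} {as : List A} {bs : List B} {a : A} →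
               Pointwise R as bs → a ∈ as → ∃ λ b → b ∈ bs × R a b
Pointwise-∈ˡ (r ∷ _)  (here refl) = _ , here refl , r
Pointwise-∈ˡ (_ ∷ rs) (there a∈) with Pointwise-∈ˡ rs a∈
... | b , b∈ , r = b , there b∈ , r

Pointwise-∈ʳ : {A B : Set} {R : A → B → Set} {as : List A} {bs : List B} {b : B} →
               Pointwise R as bs → b ∈ bs → ∃ λ a → a ∈ as × R a b
Pointwise-∈ʳ (r ∷ _)  (here refl) = _ , here refl , r
Pointwise-∈ʳ (_ ∷ rs) (there b∈) with Pointwise-∈ʳ rs b∈
... | a , a∈ , r = a , there a∈ , r

prefix-last : (ρ : Pid) → ρ ≢ [] → ρ ≡ prefix ρ ++ [ lastC ρ ]
prefix-last []          ne = ⊥-elim (ne refl)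
prefix-last (x ∷ [])    ne = refl
prefix-last (x ∷ y ∷ r) ne = cong (x ∷_) (prefix-last (y ∷ r) (λ ()))

prefix-snoc : (π : Pid) (z : ℕ) → prefix (π ++ [ z ]) ≡ π
prefix-snoc []           z = refl
prefix-snoc (x ∷ [])     z = refl
prefix-snoc (x ∷ y ∷ ys) z = cong (x ∷_) (prefix-snoc (y ∷ ys) z)

snoc≢[] : (π : Pid) (z : ℕ) → π ++ [ z ] ≢ []
snoc≢[] π z eq with ++-conicalʳ π [ z ] eq
... | ()

subpid-trans : ∀ {π ρ σ} → π ∈subpid ρ → ρ ∈subpid σ → π ∈subpid σ
subpid-trans π≤ρ (self _)      = π≤ρ
subpid-trans π≤ρ (up ne ρ≤σ′) = up ne (subpid-trans π≤ρ ρ≤σ′)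

subpid-++ : (e a : Pid) → a ≢ [] → a ∈subpid (a ++ e)
subpid-++ []      a ne = subst (a ∈subpid_) (sym (++-identityʳ a)) (self ne)
subpid-++ (z ∷ e) a ne =
  subst (a ∈subpid_) (++-assoc a [ z ] e) (subpid-trans a≤az (subpid-++ e (a ++ [ z ]) (snoc≢[] a z)))
  where
  a≤az : a ∈subpid (a ++ [ z ])
  a≤az = up (snoc≢[] a z) (subst (a ∈subpid_) (sym (prefix-snoc a z)) (self ne))

subpid⇒prefix : ∀ {π ρ} → π ∈subpid ρ → ∃ λ d → ρ ≡ π ++ d
subpid⇒prefix {π} (self _) = [] , sym (++-identityʳ π)
subpid⇒prefix {π} {ρ} (up ne π≤ρ′) with subpid⇒prefix π≤ρ′
... | d , eq = d ++ [ lastC ρ ] ,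
  trans (prefix-last ρ ne) (trans (cong (_++ [ lastC ρ ]) eq) (++-assoc π d [ lastC ρ ]))

singleton-++ : (a p : Pid) (z : ℕ) → a ≢ [] → [ z ] ≡ a ++ p → a ≡ [ z ]
singleton-++ []          p z ne _    = ⊥-elim (ne refl)
singleton-++ (b ∷ [])    p z ne refl = refl
singleton-++ (b ∷ c ∷ a) p z ne ()

Descendant : Pid → Pid → ℕ → Set
Descendant ρ π j = ∃ λ d → ρ ≡ π ++ (j ∷ d)

descendant-of-child : ∀ {ρ π z j} → Descendant ρ (π ++ [ z ]) j → Descendant ρ π z
descendant-of-child {π = π} {z} {j} (d , eq) = j ∷ d , trans eq (++-assoc π [ z ] (j ∷ d))

descendant-snoc : (σ π : Pid) (z j : ℕ) (e : Pid) → σ ++ [ z ] ≡ π ++ (j ∷ e) →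
                  (e ≡ [] × σ ≡ π × z ≡ j) ⊎ Descendant σ π j
descendant-snoc σ π z j e eq with ++-split σ [ z ] π (j ∷ e) eq
... | inj₁ ([] , p , refl)         = inj₁ (refl , trans (sym (++-identityʳ σ)) (sym p) , refl)
... | inj₁ (y ∷ [] , p , ())
... | inj₁ (y ∷ w ∷ _ , p , ())
... | inj₂ ([] , p , refl)         = inj₁ (refl , trans p (++-identityʳ π) , refl)
... | inj₂ (y ∷ e′ , p , q) with ∷-injective q
...   | refl , _ = inj₂ (e′ , p)

module _ {Dd : DataDom} (N : TNet Dd) where

  -- Subtree addressing in pid-trees

  Compatible-sym : ∀ {a b} → Compatible N a b → Compatible N b a
  Compatible-sym (a≢b , a∉b , b∉a) = (λ eq → a≢b (sym eq)) , b∉a , a∉b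

  ¬Compatible-++ : ∀ {a b} e → a ≢ [] → b ≡ a ++ e → ¬ Compatible N a b
  ¬Compatible-++ {a} []      _  eq   (a≢b , _ , _) = a≢b (sym (trans eq (++-identityʳ a)))
  ¬Compatible-++ {a} (z ∷ e) ne refl (_ , a∉b , _) = a∉b (subpid-++ (z ∷ e) a ne)

  child≢[] : ∀ {u a t} → IsPidTree N u → (a , t) ∈ children N u → a ≢ []
  child≢[] (ptree ne _ _) a∈ = All.lookup ne a∈

  same-child : ∀ {M cs a b tᵃ tᵇ} X Y → IsPidTree N (node M cs) →
               (a , tᵃ) ∈ cs → (b , tᵇ) ∈ cs → a ++ X ≡ b ++ Y → a ≡ b × tᵃ ≡ tᵇ
  same-child X Y ip@(ptree _ compat _) a∈ b∈ eq
    with AllPairs-pick (AllPairsP.map⁻ compat) a∈ b∈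
  ... | inj₁ refl = refl , refl
  ... | inj₂ compat-ab with ++-split _ X _ Y eq | [ id , Compatible-sym ]′ compat-ab
  ...   | inj₁ (e , b≡ae , _) | a~b = ⊥-elim (¬Compatible-++ e (child≢[] ip a∈) b≡ae a~b)
  ...   | inj₂ (e , a≡be , _) | a~b = ⊥-elim (¬Compatible-++ e (child≢[] ip b∈) a≡be (Compatible-sym a~b))

  SubAt-IsPidTree : ∀ {T x u} → IsPidTree N T → SubAt N T x u → IsPidTree N u
  SubAt-IsPidTree ip                here            = ip
  SubAt-IsPidTree (ptree _ _ sub) (there c∈ s _) = SubAt-IsPidTree (All.lookup sub c∈) s

  SubAt-++ : ∀ {T x u d w} → SubAt N T x u → SubAt N u d w → SubAt N T (x ++ d) w
  SubAt-++ here s₂ = s₂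
  SubAt-++ {d = d} (there {a = a} {π' = x′} c∈ s₁ refl) s₂ = there c∈ (SubAt-++ s₁ s₂) (++-assoc a x′ d)

  SubAt-descend : ∀ {T x u w} d → IsPidTree N T → SubAt N T x u → SubAt N T (x ++ d) w → SubAt N u d w
  SubAt-descend d ip s₁ s₂ = go d ip s₁ s₂ refl
    where
    go : ∀ {T x u z w} d → IsPidTree N T → SubAt N T x u → SubAt N T z w → z ≡ x ++ d → SubAt N u d w
    go d ip here s₂ refl = s₂
    go d (ptree ne _ _) (there {a = a} {π' = x′} c∈ _ refl) here eq =
      ⊥-elim (All.lookup ne c∈ (++-conicalˡ a (x′ ++ d) (sym (trans eq (++-assoc a x′ d)))))
    go d ip@(ptree _ _ sub) (there {a = a} {π' = x′} c∈ s₁ refl) (there {π' = y} c∈′ s₂ refl) eq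
      with same-child (x′ ++ d) y ip c∈ c∈′ (trans (sym (++-assoc a x′ d)) (sym eq))
    ... | refl , refl = go d (All.lookup sub c∈) s₁ s₂ (++-cancelˡ a _ _ (trans eq (++-assoc a x′ d)))

  SubAt-unique : ∀ {T x u w} → IsPidTree N T → SubAt N T x u → SubAt N T x w → u ≡ w
  SubAt-unique {x = x} ip s₁ s₂ =
    at-root (SubAt-IsPidTree ip s₁)
            (SubAt-descend [] ip s₁ (subst (λ z → SubAt N _ z _) (sym (++-identityʳ x)) s₂))
    where
    at-root : ∀ {u w} → IsPidTree N u → SubAt N u [] w → u ≡ w
    at-root _ here = refl
    at-root ip@(ptree _ _ _) (there {a = a} {π' = π′} c∈ _ eq) = ⊥-elim (child≢[] ip c∈ (++-conicalˡ a π′ (sym eq)))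

  leaf-SubAt : ∀ {u d w} → children N u ≡ [] → d ≢ [] → SubAt N u d w → ⊥
  leaf-SubAt _  ne here = ne refl
  leaf-SubAt {u = node _ []} _ _ (there () _ _)

  SubAt-step : ∀ {u z w} → IsPidTree N u → SubAt N u [ z ] w → ∃ λ t → ([ z ] , t) ∈ children N u
  SubAt-step (ptree ne _ _) (there {a = a} {π' = π′} c∈ _ eq)
    with singleton-++ a π′ _ (All.lookup ne c∈) eq
  ... | refl = _ , c∈

  no-node-inside-edge : ∀ {u a t d e w} → IsPidTree N u → (a , t) ∈ children N u →
                        a ≡ d ++ e → d ≢ [] → e ≢ [] → SubAt N u d w → ⊥
  no-node-inside-edge _ _ _ d≢[] _ here = d≢[] refl
  no-node-inside-edge {u = node _ _} {e = e} ip a∈ refl _ e≢[] (there {a = c} {π' = y} c∈ _ refl)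
    with same-child (y ++ e) [] ip c∈ a∈ (trans (sym (++-assoc c y e)) (sym (++-identityʳ _)))
  ... | c≡a , _ = e≢[] (++-conicalʳ y e (++-identityʳ-unique c (trans c≡a (++-assoc c y e))))

  SubAt-⊆T : ∀ {t π u R} → SubAt N t π u → _⊆T_ N t R → ∃ λ u′ → SubAt N R π u′
  SubAt-⊆T here _ = _ , here
  SubAt-⊆T {R = node _ cs} (there {a = a} {ti = tᵃ} c∈ s eq) (incl _ sub) with matching (All.lookup sub c∈)
    where
    matching : ∀ {cs′} → Any (λ c → a ≡ proj₁ c × _⊆T_ N tᵃ (proj₂ c)) cs′ →
               ∃ λ t′ → (a , t′) ∈ cs′ × _⊆T_ N tᵃ t′
    matching (here (refl , tᵃ⊆)) = _ , here refl , tᵃ⊆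
    matching (there m) with matching m
    ... | t′ , c∈′ , tᵃ⊆ = t′ , there c∈′ , tᵃ⊆
  ... | t′ , c∈′ , tᵃ⊆ with SubAt-⊆T s tᵃ⊆
  ... | u′ , s′ = u′ , there c∈′ s′ eq

  path-node : ∀ {R π M′} → ContainsPath N R π M′ → ∃ λ u → SubAt N R π u
  path-node (_ , (_ , s , _) , t⊆R) = SubAt-⊆T s t⊆R

  nth→∈ : ∀ {A : Set} {cs : List A} {i c} → nth N cs i ≡ just c → c ∈ cs
  nth→∈ {cs = _ ∷ _} {zero}  refl = here refl
  nth→∈ {cs = _ ∷ _} {suc i}  e    = there (nth→∈ e)

  ∈→nth : ∀ {A : Set} {cs : List A} {c} → c ∈ cs → ∃ λ i → nth N cs i ≡ just c
  ∈→nth (here refl) = zero , refl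
  ∈→nth (there c∈) with ∈→nth c∈
  ... | i , e = suc i , e

  nth-length : ∀ {A B : Set} {cs : List A} {cs′ : List B} {i c} →
               length cs ≡ length cs′ → nth N cs i ≡ just c → ∃ λ c′ → nth N cs′ i ≡ just c′
  nth-length {cs = _ ∷ _}  {c′ ∷ _}  {zero} _  refl = c′ , refl
  nth-length {cs = _ ∷ cs} {_ ∷ cs′} {suc i}  eq e    = nth-length {cs = cs} {cs′} (suc-injective eq) e

  data Route : Tree N → List ℕ → Pid → Tree N → Set where
    rnil  : ∀ {t} → Route t [] [] t
    rcons : ∀ {t i a tᵢ r π′ π u} → nth N (children N t) i ≡ just (a , tᵢ) →
            Route tᵢ r π′ u → π ≡ a ++ π′ → Route t (i ∷ r) π u

  RelPath→Route : ∀ {T π r} → RelPath N T π r → ∃ λ u → Route T r π u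
  RelPath→Route root = _ , rnil
  RelPath→Route (child e rp eq) with RelPath→Route rp
  ... | u , ro = u , rcons e ro eq

  Route→RelPath : ∀ {T π r u} → Route T r π u → RelPath N T π r
  Route→RelPath rnil             = root
  Route→RelPath (rcons e ro eq) = child e (Route→RelPath ro) eq

  Route→SubAt : ∀ {T π r u} → Route T r π u → SubAt N T π u
  Route→SubAt rnil             = here
  Route→SubAt (rcons e ro eq) = there (nth→∈ e) (Route→SubAt ro) eq

  Route-snoc : ∀ {T π r u k a t} → Route T r π u → nth N (children N u) k ≡ just (a , t) →
               Route T (r ++ [ k ]) (π ++ a) t
  Route-snoc {a = a} rnil e = rcons e rnil (sym (++-identityʳ a))
  Route-snoc {a = a} (rcons {a = b} {π′ = π′} e ro refl) e′ = rcons e (Route-snoc ro e′) (++-assoc b π′ a)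

  RelPath-root : ∀ {T r} → IsPidTree N T → RelPath N T [] r → r ≡ []
  RelPath-root _ root = refl
  RelPath-root (ptree ne _ _) (child {a = a} {π' = π′} e _ eq) =
    ⊥-elim (All.lookup ne (nth→∈ e) (++-conicalˡ a π′ (sym eq)))

  RelPath-[] : ∀ {T x} → RelPath N T x [] → x ≡ []
  RelPath-[] root = refl

  module _ {h : Pid → Pid → Set} where

    NodeSim-children : ∀ {u u′} → NodeSim N h u u′ → length (children N u) ≡ length (children N u′)
    NodeSim-children {node _ _} {node _ _} (same-length , _ , _) = same-length

    NodeSim-marks : ∀ {u u′} → NodeSim N h u u′ → ∀ s →
                    ∃ λ ys → Pointwise (TupRel N h (typ N s)) (mark N u s) ys × (mark N u′ s ↭ ys)
    NodeSim-marks {node _ _} {node _ _} (_ , marks , _) = marks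

    NodeSim-token→ : ∀ {u u′ s v} → NodeSim N h u u′ → v ∈ mark N u s →
                     ∃ λ v′ → v′ ∈ mark N u′ s × TupRel N h (typ N s) v v′
    NodeSim-token→ {s = s} sim v∈ with NodeSim-marks sim s
    ... | _ , pw , perm with Pointwise-∈ˡ pw v∈
    ... | v′ , v′∈ , rel = v′ , ∈-resp-↭ (↭-sym perm) v′∈ , rel

    NodeSim-token← : ∀ {u u′ s v′} → NodeSim N h u u′ → v′ ∈ mark N u′ s →
                     ∃ λ v → v ∈ mark N u s × TupRel N h (typ N s) v v′
    NodeSim-token← {s = s} sim v′∈ with NodeSim-marks sim s
    ... | _ , pw , perm = Pointwise-∈ʳ pw (∈-resp-↭ perm v′∈)

    TupRel-pid→ : ∀ xs {v v′ x} → TupRel N h xs v v′ → x ∈ pidsOf Dd xs v →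
                  ∃ λ y → y ∈ pidsOf Dd xs v′ × h x y
    TupRel-pid→ (P ∷ xs)  (r , _)  (here refl) = _ , here refl , r
    TupRel-pid→ (P ∷ xs)  (_ , rs) (there x∈) with TupRel-pid→ xs rs x∈
    ... | y , y∈ , r = y , there y∈ , r
    TupRel-pid→ (Dt ∷ xs) (_ , rs) x∈ = TupRel-pid→ xs rs x∈

    TupRel-pid← : ∀ xs {v v′ y} → TupRel N h xs v v′ → y ∈ pidsOf Dd xs v′ →
                  ∃ λ x → x ∈ pidsOf Dd xs v × h x y
    TupRel-pid← (P ∷ xs)  (r , _)  (here refl) = _ , here refl , r
    TupRel-pid← (P ∷ xs)  (_ , rs) (there y∈) with TupRel-pid← xs rs y∈
    ... | x , x∈ , r = x , there x∈ , r
    TupRel-pid← (Dt ∷ xs) (_ , rs) y∈ = TupRel-pid← xs rs y∈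

    NodeSim-leaf→ : ∀ {u u′} → NodeSim N h u u′ → children N u ≡ [] → children N u′ ≡ []
    NodeSim-leaf→ {u′ = node _ []}    _   _  = refl
    NodeSim-leaf→ {u′ = node _ (_ ∷ _)} sim eq with trans (sym (NodeSim-children sim)) (cong length eq)
    ... | ()

    NodeSim-leaf← : ∀ {u u′} → NodeSim N h u u′ → children N u′ ≡ [] → children N u ≡ []
    NodeSim-leaf← {u = node _ []}    _   _  = refl
    NodeSim-leaf← {u = node _ (_ ∷ _)} sim eq with trans (NodeSim-children sim) (cong length eq)
    ... | ()

    NodeSim-empty→ : ∀ {u u′ s} → NodeSim N h u u′ → mark N u s ≡ [] → mark N u′ s ≡ []
    NodeSim-empty→ sim empty = no-members⇒[] λ v′∈ → ∈-[] empty (proj₁ (proj₂ (NodeSim-token← sim v′∈)))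

    NodeSim-empty← : ∀ {u u′ s} → NodeSim N h u u′ → mark N u′ s ≡ [] → mark N u s ≡ []
    NodeSim-empty← sim empty = no-members⇒[] λ v∈ → ∈-[] empty (proj₁ (proj₂ (NodeSim-token→ sim v∈)))

  -- Three features of pid-trees, preserved by ∼_h

  Referenced : Tree N → Pid → Set
  Referenced R x = ∃ λ π → ∃ λ u → ∃ λ s → ∃ λ v →
                   SubAt N R π u × v ∈ mark N u s × x ∈ pidsOf Dd (typ N s) v

  FreshLeaf : Tree N → Pid → Set
  FreshLeaf R x = x ≢ []
                × (∃ λ u → SubAt N R x u × children N u ≡ [] × (∀ s → mark N u s ≡ []))
                × ¬ Referenced R x

  FreshParent : Tree N → Pid → Set
  FreshParent R x = ∃ λ u → SubAt N R x u × ∃ λ a → ∃ λ t → (a , t) ∈ children N u × FreshLeaf R (x ++ a)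

  module Transfer (R R′ : Tree N) (ipR : IsPidTree N R) (ipR′ : IsPidTree N R′) (eqv : Equiv N R R′) where

    h : Pid → Pid → Set
    h = hRel N R R′

    h-bijection : IsBijection N h (pidT N R) (pidT N R′)
    h-bijection = proj₁ eqv

    h-dom : ∀ {x y} → h x y → pidT N R x × pidT N R′ y
    h-dom {x} {y} = proj₁ h-bijection x y

    h-total : ∀ {x} → pidT N R x → ∃ λ y → h x y
    h-total {x} = proj₁ (proj₂ h-bijection) x

    h-functional : ∀ {x y y′} → h x y → h x y′ → y ≡ y′
    h-functional {x} {y} {y′} = proj₁ (proj₂ (proj₂ h-bijection)) x y y′

    h-injective : ∀ {x x′ y} → h x y → h x′ y → x ≡ x′
    h-injective {x} {x′} {y} = proj₁ (proj₂ (proj₂ (proj₂ h-bijection))) x x′ y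

    h-surjective : ∀ {y} → pidT N R′ y → ∃ λ x → h x y
    h-surjective {y} = proj₂ (proj₂ (proj₂ (proj₂ h-bijection))) y

    h-sim : ∀ {π π′ u u′} → SubAt N R π u → SubAt N R′ π′ u′ → h π π′ → NodeSim N h u u′
    h-sim {π} {π′} {u} {u′} = proj₂ eqv π π′ u u′

    -- h relates exactly the roots (in pid-trees only the root has relative path ⟨⟩).
    h-root→ : ∀ {x x′} → h x x′ → x ≡ [] → x′ ≡ []
    h-root→ (_ , _ , _ , rp , rp′) refl with RelPath-root ipR rp
    ... | refl = RelPath-[] rp′

    h-root← : ∀ {x x′} → h x x′ → x′ ≡ [] → x ≡ []
    h-root← (_ , _ , _ , rp , rp′) refl with RelPath-root ipR′ rp′
    ... | refl = RelPath-[] rp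

    routes-h : ∀ {r x x′ u u′} → Route R r x u → Route R′ r x′ u′ → h x x′
    routes-h ro ro′ = (_ , Route→SubAt ro) , (_ , Route→SubAt ro′) , _ , Route→RelPath ro , Route→RelPath ro′

    h-child→ : ∀ {x x′ u a t} → h x x′ → SubAt N R x u → (a , t) ∈ children N u →
               ∃ λ u′ → SubAt N R′ x′ u′ ×
               ∃ λ a′ → ∃ λ t′ → (a′ , t′) ∈ children N u′ × h (x ++ a) (x′ ++ a′)
    h-child→ {u = u} hx@(_ , _ , _ , rp , rp′) sp a∈ with RelPath→Route rp | RelPath→Route rp′
    ... | _ , ro | u′ , ro′ with SubAt-unique ipR sp (Route→SubAt ro)
    ... | refl with ∈→nth a∈
    ... | k , e with nth-length {cs = children N u} {cs′ = children N u′}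
                       (NodeSim-children (h-sim (Route→SubAt ro) (Route→SubAt ro′) hx)) e
    ... | (a′ , t′) , e′ =
      _ , Route→SubAt ro′ , a′ , t′ , nth→∈ e′ , routes-h (Route-snoc ro e) (Route-snoc ro′ e′)

    h-child← : ∀ {x x′ u′ a′ t′} → h x x′ → SubAt N R′ x′ u′ → (a′ , t′) ∈ children N u′ →
               ∃ λ u → SubAt N R x u ×
               ∃ λ a → ∃ λ t → (a , t) ∈ children N u × h (x ++ a) (x′ ++ a′)
    h-child← {u′ = u′} hx@(_ , _ , _ , rp , rp′) sp′ a′∈ with RelPath→Route rp | RelPath→Route rp′
    ... | u , ro | _ , ro′ with SubAt-unique ipR′ sp′ (Route→SubAt ro′)
    ... | refl with ∈→nth a′∈
    ... | k , e′ with nth-length {cs = children N u′} {cs′ = children N u}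
                        (sym (NodeSim-children (h-sim (Route→SubAt ro) (Route→SubAt ro′) hx))) e′
    ... | (a , t) , e =
      _ , Route→SubAt ro , a , t , nth→∈ e , routes-h (Route-snoc ro e) (Route-snoc ro′ e′)

    referenced→ : ∀ {x x′} → h x x′ → Referenced R x → Referenced R′ x′
    referenced→ hx (_ , _ , s , _ , sp , v∈ , x∈) with h-total (_ , sp)
    ... | _ , hp with proj₂ (h-dom hp)
    ... | u′ , sp′ = found (NodeSim-token→ (h-sim sp sp′ hp) v∈)
      where
      found : (∃ λ v′ → v′ ∈ mark N u′ s × TupRel N h (typ N s) _ v′) → Referenced R′ _
      found (v′ , v′∈ , rel) with TupRel-pid→ (typ N s) rel x∈
      ... | _ , y∈ , hy =
        _ , u′ , s , v′ , sp′ , v′∈ , subst (_∈ pidsOf Dd (typ N s) v′) (h-functional hy hx) y∈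

    referenced← : ∀ {x x′} → h x x′ → Referenced R′ x′ → Referenced R x
    referenced← hx (_ , _ , s , _ , sp′ , v′∈ , x′∈) with h-surjective (_ , sp′)
    ... | _ , hp with proj₁ (h-dom hp)
    ... | u , sp = found (NodeSim-token← (h-sim sp sp′ hp) v′∈)
      where
      found : (∃ λ v → v ∈ mark N u s × TupRel N h (typ N s) v _) → Referenced R _
      found (v , v∈ , rel) with TupRel-pid← (typ N s) rel x′∈
      ... | _ , y∈ , hy =
        _ , u , s , v , sp , v∈ , subst (_∈ pidsOf Dd (typ N s) v) (h-injective hy hx) y∈

    freshLeaf→ : ∀ {x x′} → h x x′ → FreshLeaf R x → FreshLeaf R′ x′
    freshLeaf→ hx (x≢[] , (u , sp , leaf , empty) , unreferenced) with proj₂ (h-dom hx)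
    ... | u′ , sp′ =
      (λ eq → x≢[] (h-root← hx eq)) ,
      (u′ , sp′ , NodeSim-leaf→ sim leaf , λ s → NodeSim-empty→ sim (empty s)) ,
      (λ r → unreferenced (referenced← hx r))
      where
      sim : NodeSim N h u u′
      sim = h-sim sp sp′ hx

    freshLeaf← : ∀ {x x′} → h x x′ → FreshLeaf R′ x′ → FreshLeaf R x
    freshLeaf← hx (x′≢[] , (u′ , sp′ , leaf , empty) , unreferenced) with proj₁ (h-dom hx)
    ... | u , sp =
      (λ eq → x′≢[] (h-root→ hx eq)) ,
      (u , sp , NodeSim-leaf← sim leaf , λ s → NodeSim-empty← sim (empty s)) ,
      (λ r → unreferenced (referenced→ hx r))
      where
      sim : NodeSim N h u u′
      sim = h-sim sp sp′ hx

    freshParent→ : ∀ {x x′} → h x x′ → FreshParent R x → FreshParent R′ x′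
    freshParent→ hx (_ , sp , _ , _ , a∈ , leaf) with h-child→ hx sp a∈
    ... | u′ , sp′ , a′ , t′ , a′∈ , hxa = u′ , sp′ , a′ , t′ , a′∈ , freshLeaf→ hxa leaf

    freshParent← : ∀ {x x′} → h x x′ → FreshParent R′ x′ → FreshParent R x
    freshParent← hx (_ , sp′ , _ , _ , a′∈ , leaf) with h-child← hx sp′ a′∈
    ... | u , sp , a , t , a∈ , hxa = u , sp , a , t , a∈ , freshLeaf← hxa leaf

  -- The freshness invariant of reachable markings

  Fresh : Marking N → Set
  Fresh M = ∀ {π i ρ j} → (π , i) ∈ gen M → pidM N M ρ → Descendant ρ π j → j ≤ i

  DifferentPid : Pid × ℕ → Pid × ℕ → Set
  DifferentPid e e′ = proj₁ e ≢ proj₁ e′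

  DifferentPid-sym : ∀ {e e′} → DifferentPid e e′ → DifferentPid e′ e
  DifferentPid-sym e≢e′ eq = e≢e′ (sym eq)

  DistinctGen : Marking N → Set
  DistinctGen M = AllPairs DifferentPid (gen M)

  DifferentPid-resp-↭ : ∀ {xs ys} → xs ↭ ys → AllPairs DifferentPid xs → AllPairs DifferentPid ys
  DifferentPid-resp-↭ = AllPairs-resp-↭ λ {e} {e′} → DifferentPid-sym {e} {e′}

  module Firing (t : Fin (TNet.nT N)) (β : Binding N t) {M M′ : Marking N} (fires : Fires N t M β M′)
                (fresh : Fresh M) (distinct : DistinctGen M) where
    T : Trans Dd (TNet.nS N) (typ N)
    T = TNet.trans N t

    K : ℕ
    K = Trans.k T

    nOut : Fin K → ℕ
    nOut = Trans.nOut T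

    p : Fin K → Pid
    p i = Binding.bp β (inj₁ i)

    c : Fin K → ℕ
    c i = Binding.bc β i

    -- the consumed generator tokens ⟨p_i,c_i⟩, i ≤ m, that are put back
    L : Fin (Trans.m T) → Fin K
    L i = inject≤ i (Trans.m≤k T)

    newChild : (l : Fin K) → Fin (nOut l) → Pid
    newChild l j = p l ++ [ c l + suc (toℕ j) ]

    bornFrom : Fin K → List (Pid × ℕ)
    bornFrom l = map (λ j → newChild l j , 0) (allFin (nOut l))

    consumed kept born : List (Pid × ℕ)
    consumed = map (λ i → p i , c i) (allFin K)
    kept     = map (λ i → p (L i) , c (L i) + nOut (L i)) (allFin (Trans.m T))
    born     = concatMap bornFrom (allFin K)

    Born : Pid → Set
    Born ρ = ∃ λ l → ∃ λ (j : Fin (nOut l)) → ρ ≡ newChild l j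

    rest : List (Pid × ℕ)
    rest = proj₁ (proj₁ fires)

    gen-before : gen M ↭ consumed ++ rest
    gen-before = proj₁ (proj₂ (proj₁ fires))

    gen-after : gen M′ ↭ (kept ++ born) ++ rest
    gen-after = proj₂ (proj₂ (proj₁ fires))

    consumed∈gen : ∀ i → (p i , c i) ∈ gen M
    consumed∈gen i = ∈-resp-↭ (↭-sym gen-before) (∈-++⁺ˡ (∈-map⁺ _ (∈-allFin i)))

    rest⊆gen : ∀ {e} → e ∈ rest → e ∈ gen M
    rest⊆gen e∈ = ∈-resp-↭ (↭-sym gen-before) (∈-++⁺ʳ consumed e∈)

    distinct-before : AllPairs DifferentPid consumed × AllPairs DifferentPid rest
                    × All (λ e → All (DifferentPid e) rest) consumed
    distinct-before = AllPairs-++⁻ consumed (DifferentPid-resp-↭ gen-before distinct)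

    consumed-injective : ∀ {i j} → p i ≡ p j → i ≡ j
    consumed-injective {i} {j} eq
      with AllPairs-pick (AllPairsP.map⁻ (proj₁ distinct-before)) (∈-allFin i) (∈-allFin j)
    ... | inj₁ i≡j        = i≡j
    ... | inj₂ (inj₁ pi≢pj) = ⊥-elim (pi≢pj eq)
    ... | inj₂ (inj₂ pj≢pi) = ⊥-elim (pj≢pi (sym eq))

    rest-avoids-consumed : ∀ {e} → e ∈ rest → ∀ i → proj₁ e ≢ p i
    rest-avoids-consumed e∈ i eq =
      All.lookup (All.lookup (proj₂ (proj₂ distinct-before)) (∈-map⁺ _ (∈-allFin i))) e∈ (sym eq)

    born-unused : ∀ l j {ρ} → pidM N M ρ → ¬ Descendant ρ (p l) (c l + suc j)
    born-unused l j pr d = m+1+n≰m (c l) (fresh (consumed∈gen l) pr d)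

    gen-after-cases : ∀ {π i} → (π , i) ∈ gen M′ →
                      (π , i) ∈ rest
                    ⊎ (∃ λ l → π ≡ p (L l) × i ≡ c (L l) + nOut (L l))
                    ⊎ (∃ λ l → ∃ λ (j : Fin (nOut l)) → π ≡ newChild l j × i ≡ 0)
    gen-after-cases π∈ with ∈-++⁻ (kept ++ born) (∈-resp-↭ gen-after π∈)
    ... | inj₂ π∈rest = inj₁ π∈rest
    ... | inj₁ π∈new with ∈-++⁻ kept π∈new
    ...   | inj₁ π∈kept with ∈-map⁻ _ π∈kept
    ...     | l , _ , refl = inj₂ (inj₁ (l , refl , refl))
    gen-after-cases π∈ | inj₁ π∈new | inj₂ π∈born with find (∈-concatMap⁻ _ {xs = allFin K} π∈born)
    ...     | l , _ , π∈bornFrom with ∈-map⁻ _ π∈bornFrom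
    ...       | j , _ , refl = inj₂ (inj₂ (l , j , refl , refl))

    output-pid : ∀ xs o {ρ} → ρ ∈ pidsOf Dd xs (evOut N t β xs o) → ∃ λ e → ρ ≡ evPid N t β e
    output-pid (P ∷ xs)  (e , _) (here eq)  = e , eq
    output-pid (P ∷ xs)  (_ , o) (there ρ∈) = output-pid xs o ρ∈
    output-pid (Dt ∷ xs) (_ , o) ρ∈         = output-pid xs o ρ∈

    pid-after : ∀ {ρ} → pidM N M′ ρ → pidM N M ρ ⊎ Born ρ
    pid-after (inj₁ (i , ρ∈)) with gen-after-cases ρ∈
    ... | inj₁ ρ∈rest                     = inj₁ (inj₁ (i , rest⊆gen ρ∈rest))
    ... | inj₂ (inj₁ (l , refl , _))      = inj₁ (inj₁ (_ , consumed∈gen (L l)))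
    ... | inj₂ (inj₂ (l , j , refl , _))  = inj₂ (l , j , refl)
    pid-after (inj₂ (s , v , v∈ , ρ∈)) with proj₂ (proj₁ (proj₂ fires) s)
    ... | before , after with ∈-++⁻ (map (evOut N t β (typ N s)) (Trans.outArc T s)) (∈-resp-↭ after v∈)
    ...   | inj₂ v∈rest = inj₁ (inj₂ (s , v , ∈-resp-↭ (↭-sym before) (∈-++⁺ʳ _ v∈rest) , ρ∈))
    ...   | inj₁ v∈out with ∈-map⁻ (evOut N t β (typ N s)) v∈out
    ...     | o , _ , refl with output-pid (typ N s) o ρ∈
    ...       | keep l , refl  = inj₁ (inj₁ (_ , consumed∈gen (L l)))
    ...       | new l j , refl = inj₂ (l , j , refl)

    fresh-rest : ∀ {π i ρ j} → (π , i) ∈ rest → pidM N M′ ρ → Descendant ρ π j → j ≤ i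
    fresh-rest π∈ pr d with pid-after pr
    ... | inj₁ old = fresh (rest⊆gen π∈) old d
    ... | inj₂ (l , _ , refl) with descendant-snoc (p l) _ _ _ (proj₁ d) (proj₂ d)
    ...   | inj₁ (_ , pl≡π , _) = ⊥-elim (rest-avoids-consumed π∈ l (sym pl≡π))
    ...   | inj₂ d′             = fresh (rest⊆gen π∈) (inj₁ (c l , consumed∈gen l)) d′

    fresh-kept : ∀ l {ρ j} → pidM N M′ ρ → Descendant ρ (p (L l)) j → j ≤ c (L l) + nOut (L l)
    fresh-kept l pr d with pid-after pr
    ... | inj₁ old = ≤-trans (fresh (consumed∈gen (L l)) old d) (m≤m+n _ _)
    ... | inj₂ (l′ , j′ , refl) with descendant-snoc (p l′) (p (L l)) _ _ (proj₁ d) (proj₂ d)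
    ...   | inj₂ d′ = ≤-trans (fresh (consumed∈gen (L l)) (inj₁ (c l′ , consumed∈gen l′)) d′) (m≤m+n _ _)
    ...   | inj₁ (_ , same , x≡j) with consumed-injective same
    ...     | refl = subst (_≤ c (L l) + nOut (L l)) x≡j (+-monoʳ-≤ (c (L l)) (toℕ<n j′))

    fresh-born : ∀ l (j₀ : Fin (nOut l)) {ρ j} → pidM N M′ ρ → ¬ Descendant ρ (newChild l j₀) j
    fresh-born l j₀ pr d with pid-after pr
    ... | inj₁ old = born-unused l _ old (descendant-of-child d)
    ... | inj₂ (l′ , _ , refl) with descendant-snoc (p l′) (p l ++ [ _ ]) _ _ (proj₁ d) (proj₂ d)
    ...   | inj₁ (_ , same , _) = born-unused l _ (inj₁ (c l′ , consumed∈gen l′)) ([] , same)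
    ...   | inj₂ d′             = born-unused l _ (inj₁ (c l′ , consumed∈gen l′)) (descendant-of-child d′)

    fresh-after : Fresh M′
    fresh-after π∈ pr d with gen-after-cases π∈
    ... | inj₁ π∈rest                       = fresh-rest π∈rest pr d
    ... | inj₂ (inj₁ (l , refl , refl))     = fresh-kept l pr d
    ... | inj₂ (inj₂ (l , j₀ , refl , refl)) = ⊥-elim (fresh-born l j₀ pr d)

    -- Distinctness after the firing: kept pids are the distinct p_{L l},
    -- born pids are distinct new children, and all avoid the rest.
    kept-member : ∀ {e} → e ∈ kept → ∃ λ l → e ≡ (p (L l) , c (L l) + nOut (L l))
    kept-member e∈ with ∈-map⁻ _ e∈
    ... | l , _ , eq = l , eq

    bornFrom-member : ∀ {l e} → e ∈ bornFrom l →
                      ∃ λ (j : Fin (nOut l)) → e ≡ (newChild l j , 0)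
    bornFrom-member e∈ with ∈-map⁻ _ e∈
    ... | j , _ , eq = j , eq

    born-member : ∀ {e} → e ∈ born → ∃ λ l → ∃ λ (j : Fin (nOut l)) → e ≡ (newChild l j , 0)
    born-member e∈ with find (∈-concatMap⁻ _ {xs = allFin K} e∈)
    ... | l , _ , e∈bornFrom = l , bornFrom-member e∈bornFrom

    kept-distinct : AllPairs DifferentPid kept
    kept-distinct = AllPairsP.map⁺ (AllPairsP.tabulate⁺ {f = λ i → i} λ i≢j eq →
      i≢j (inject≤-injective _ _ _ _ (consumed-injective eq)))

    born-distinct : AllPairs DifferentPid born
    born-distinct = AllPairsP.concat⁺ (AllP.map⁺ (All.tabulate λ {l} _ → within l))
                      (AllPairsP.map⁺ (AllPairsP.tabulate⁺ {f = λ l → l} λ l≢l′ →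
                         All.tabulate λ e∈ → All.tabulate λ e′∈ → across l≢l′ e∈ e′∈))
      where
      -- siblings born from one parent differ in their last component
      within : ∀ l → AllPairs DifferentPid (bornFrom l)
      within l = AllPairsP.map⁺ (AllPairsP.tabulate⁺ {f = λ j → j} λ j≢j′ eq →
        j≢j′ (toℕ-injective (suc-injective (+-cancelˡ-≡ (c l) _ _ (proj₂ (∷ʳ-injective _ _ eq))))))
      -- pids born from different parents have different prefixes
      across : ∀ {l l′ e e′} → l ≢ l′ → e ∈ bornFrom l → e′ ∈ bornFrom l′ → DifferentPid e e′
      across l≢l′ e∈ e′∈ eq with bornFrom-member e∈ | bornFrom-member e′∈
      ... | _ , refl | _ , refl = l≢l′ (consumed-injective (proj₁ (∷ʳ-injective _ _ eq)))

    kept-born-apart : All (λ e → All (DifferentPid e) born) kept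
    kept-born-apart = All.tabulate λ e∈ → All.tabulate λ e′∈ → apart (kept-member e∈) (born-member e′∈)
      where
      apart : ∀ {e e′} → (∃ λ l → e ≡ (p (L l) , c (L l) + nOut (L l))) →
              (∃ λ l → ∃ λ (j : Fin (nOut l)) → e′ ≡ (newChild l j , 0)) → DifferentPid e e′
      apart (l , refl) (l′ , j , refl) eq = born-unused l′ (toℕ j) (inj₁ (_ , consumed∈gen (L l))) ([] , eq)

    new-rest-apart : All (λ e → All (DifferentPid e) rest) (kept ++ born)
    new-rest-apart = All.tabulate λ e∈ → All.tabulate λ e′∈ eq → apart e∈ e′∈ eq
      where
      apart : ∀ {e e′} → e ∈ kept ++ born → e′ ∈ rest → proj₁ e ≡ proj₁ e′ → ⊥
      apart e∈ e′∈ eq with ∈-++⁻ kept e∈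
      ... | inj₁ e∈kept with kept-member e∈kept
      ...   | l , refl = rest-avoids-consumed e′∈ (L l) (sym eq)
      apart e∈ e′∈ eq | inj₂ e∈born with born-member e∈born
      ...   | l , j , refl = born-unused l (toℕ j) (inj₁ (_ , rest⊆gen e′∈)) ([] , sym eq)

    distinct-after : DistinctGen M′
    distinct-after = DifferentPid-resp-↭ (↭-sym gen-after)
      (AllPairsP.++⁺ (AllPairsP.++⁺ kept-distinct born-distinct kept-born-apart)
                     (proj₁ (proj₂ distinct-before)) new-rest-apart)

  reachable-invariant : ∀ {M} → Reachable N M → Fresh M × DistinctGen M
  reachable-invariant {M} (initial (gen≈ , pl≈)) = fresh₀ , DifferentPid-resp-↭ (↭-sym gen≈) ([] ∷ [])
    where
    -- initially the only pid is ⟨1⟩, the generator entry ⟨⟨1⟩,0⟩ itself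
    fresh₀ : Fresh M
    fresh₀ π∈ pr (d , eq) with ∈-resp-↭ gen≈ π∈
    fresh₀ π∈ (inj₁ (_ , ρ∈)) (d , eq) | here refl with ∈-resp-↭ gen≈ ρ∈ | eq
    ... | here refl | ()
    fresh₀ π∈ (inj₂ (s , v , v∈ , ρ∈)) _ | here refl =
      ⊥-elim (∈-[] (All.lookup (TNet.init-data N s) (∈-resp-↭ (pl≈ s) v∈)) ρ∈)
  reachable-invariant (step t β r fires) with reachable-invariant r
  ... | fresh , distinct = fresh-after , distinct-after
    where open Firing t β fires fresh distinct

  TokenPid : Marking N → Pid → Set
  TokenPid M x = ∃ λ s → ∃ λ v → v ∈ pl M s × x ∈ pidsOf Dd (typ N s) v

  owner-occurs : (x : Sort) (xs : List Sort) (v : Tup Dd (x ∷ xs)) {π : Pid} →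
                 ownerV N x (proj₁ v) ≡ π → π ≢ [] → π ∈ pidsOf Dd (x ∷ xs) v
  owner-occurs P  _ _ refl _    = here refl
  owner-occurs Dt _ _ refl π≢[] = ⊥-elim (π≢[] refl)

  next-unused : ∀ {M π i ρ} → Fresh M → (π , i) ∈ gen M → pidM N M ρ → ¬ Descendant ρ π (suc i)
  next-unused fresh π∈ pr d = 1+n≰n (fresh π∈ pr d)

  below-next-unused : ∀ {M π i ρ} (a : Pid) → Fresh M → (π , i) ∈ gen M →
                      pidM N M ρ ⊎ nextpid N M ρ → a ≢ [] → ρ ≢ (π ++ [ suc i ]) ++ a
  below-next-unused [] _ _ _ a≢[] _ = a≢[] refl
  below-next-unused {π = π} {i} (b ∷ e) fresh π∈ (inj₁ pr) _ eq =
    next-unused fresh π∈ pr (b ∷ e , trans eq (++-assoc π [ suc i ] (b ∷ e)))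
  below-next-unused {π = π} {i} (b ∷ e) fresh π∈ (inj₂ (π₂ , i₂ , π₂∈ , refl)) _ eq
    with descendant-snoc π₂ π (suc i₂) (suc i) (b ∷ e) (trans eq (++-assoc π [ suc i ] (b ∷ e)))
  ... | inj₁ (() , _)
  ... | inj₂ d = next-unused fresh π∈ (inj₁ (i₂ , π₂∈)) d

  -- Pids of M as features of a representation R of M

  module Characterisation (M : Marking N) (R : Tree N) (rep : Repr N M R) (fresh : Fresh M) where
    ipR : IsPidTree N R
    ipR = proj₁ rep

    gen-rule : ∀ π i → (π , i) ∈ gen M →
               ContainsPath N R π (emptyM N) × ContainsPath N R (π ++ [ suc i ]) (emptyM N)
    gen-rule = proj₁ (proj₂ (proj₂ rep))

    token-rule : ∀ s v → v ∈ pl M s →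
                 ContainsPath N R (owner N s v) (singleM N s v)
               × All (λ ρ → ContainsPath N R ρ (emptyM N)) (pidsOf Dd (typ N s) v)
    token-rule = proj₁ (proj₂ (proj₂ (proj₂ rep)))

    nothing-beyond : ∀ π u → SubAt N R π u → π ≡ [] ⊎ ∃ λ ρ → (pidM N M ρ ⊎ nextpid N M ρ) × π ∈subpid ρ
    nothing-beyond = proj₁ (proj₂ (proj₂ (proj₂ (proj₂ rep))))

    node-marks : ∀ π u → SubAt N R π u → ∀ s → mark N u s ↭ ownedAt N M π s
    node-marks = proj₂ (proj₂ (proj₂ (proj₂ (proj₂ rep))))

    pid-node : ∀ {ρ} → pidM N M ρ → ∃ λ u → SubAt N R ρ u
    pid-node (inj₁ (i , ρ∈))             = path-node (proj₁ (gen-rule _ i ρ∈))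
    pid-node (inj₂ (s , v , v∈ , ρ∈)) = path-node (All.lookup (proj₂ (token-rule s v v∈)) ρ∈)

    next-node : ∀ {ρ} → nextpid N M ρ → ∃ λ u → SubAt N R ρ u
    next-node (π , i , π∈ , refl) = path-node (proj₂ (gen-rule π i π∈))

    used-node : ∀ {ρ} → pidM N M ρ ⊎ nextpid N M ρ → ∃ λ u → SubAt N R ρ u
    used-node (inj₁ pr) = pid-node pr
    used-node (inj₂ nx) = next-node nx

    marked→owned : ∀ {π u s v} → SubAt N R π u → v ∈ mark N u s → v ∈ pl M s × owner N s v ≡ π
    marked→owned {π} {u} {s} sp v∈ = ∈-filter⁻ (λ v → owner N s v ≟ₚ π) (∈-resp-↭ (node-marks π u sp s) v∈)

    owned→marked : ∀ {π u s v} → SubAt N R π u → v ∈ pl M s → owner N s v ≡ π → v ∈ mark N u s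
    owned→marked {π} {u} {s} sp v∈ owns =
      ∈-resp-↭ (↭-sym (node-marks π u sp s)) (∈-filter⁺ (λ v → owner N s v ≟ₚ π) v∈ owns)

    tokenPid→referenced : ∀ {x} → TokenPid M x → Referenced R x
    tokenPid→referenced (s , v , v∈ , x∈) with path-node (proj₁ (token-rule s v v∈))
    ... | u , sp = _ , u , s , v , sp , owned→marked sp v∈ refl , x∈

    referenced→tokenPid : ∀ {x} → Referenced R x → TokenPid M x
    referenced→tokenPid (_ , _ , s , v , sp , v∈ , x∈) = s , v , proj₁ (marked→owned sp v∈) , x∈

    below-leaf : ∀ {x u b d w} → SubAt N R x u → children N u ≡ [] → SubAt N R (x ++ (b ∷ d)) w → ⊥
    below-leaf sp leaf sw = leaf-SubAt leaf (λ ()) (SubAt-descend _ ipR sp sw)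

    -- The node at next_M(π) has no children: they would lie below next_M(π),
    -- yet every node of R is a subpid of a used pid.
    next-childless : ∀ {π i u} → (π , i) ∈ gen M → SubAt N R (π ++ [ suc i ]) u → children N u ≡ []
    next-childless {π} {i} {u} π∈ sp = no-members⇒[] no-child
      where
      no-child : ∀ {c} → c ∈ children N u → ⊥
      no-child {a , t} a∈ with nothing-beyond _ t (SubAt-++ sp (there a∈ here (sym (++-identityʳ a))))
      ... | inj₁ eq = snoc≢[] π (suc i) (++-conicalˡ _ a eq)
      ... | inj₂ (ρ , used , below) with subpid⇒prefix below
      ...   | d , eq = below-next-unused (a ++ d) fresh π∈ used
                         (λ ad≡[] → child≢[] (SubAt-IsPidTree ipR sp) a∈ (++-conicalˡ a d ad≡[]))
                         (trans eq (++-assoc (π ++ [ suc i ]) a d))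

    -- Next pids are fresh leaves: unused, hence unmarked, unreferenced
    -- and (by next-childless) childless.
    nextpid→freshLeaf : ∀ {x} → nextpid N M x → FreshLeaf R x
    nextpid→freshLeaf nx@(π , i , π∈ , refl) with next-node nx
    ... | u , sp = snoc≢[] π (suc i) , (u , sp , next-childless π∈ sp , unmarked) , unreferenced
      where
      unused : ¬ pidM N M (π ++ [ suc i ])
      unused pr = next-unused fresh π∈ pr ([] , refl)

      unmarked : ∀ s → mark N u s ≡ []
      unmarked s = no-members⇒[] λ {v} v∈ → let (v∈M , owns) = marked→owned sp v∈ in
        unused (inj₂ (s , v , v∈M , owner-occurs (TNet.hd N s) (TNet.tl N s) v owns (snoc≢[] π (suc i))))

      unreferenced : ¬ Referenced R (π ++ [ suc i ])
      unreferenced r = unused (inj₂ (referenced→tokenPid r))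

    -- Conversely a fresh leaf x is a used pid (nothing beyond), with
    -- nothing below it: neither a token pid (unreferenced) nor a generator
    -- pid (next_M(x) would lie below it), so a next pid.
    freshLeaf→nextpid : ∀ {x} → FreshLeaf R x → nextpid N M x
    freshLeaf→nextpid {x} (x≢[] , (u , sp , leaf , _) , unreferenced) with nothing-beyond x u sp
    ... | inj₁ x≡[] = ⊥-elim (x≢[] x≡[])
    ... | inj₂ (ρ , used , below) with subpid⇒prefix below
    ...   | b ∷ d , refl = ⊥-elim (below-leaf sp leaf (proj₂ (used-node used)))
    ...   | [] , eq with subst (λ z → pidM N M z ⊎ nextpid N M z) (trans eq (++-identityʳ x)) used
    ...     | inj₂ nx              = nx
    ...     | inj₁ (inj₂ tp)       = ⊥-elim (unreferenced (tokenPid→referenced tp))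
    ...     | inj₁ (inj₁ (i , x∈)) = ⊥-elim (below-leaf sp leaf (proj₂ (path-node (proj₂ (gen-rule x i x∈)))))

    gen→freshParent : ∀ {x i} → (x , i) ∈ gen M → FreshParent R x
    gen→freshParent {x} {i} x∈ with path-node (proj₁ (gen-rule x i x∈)) | path-node (proj₂ (gen-rule x i x∈))
    ... | u , sp | _ , sn with SubAt-step (SubAt-IsPidTree ipR sp) (SubAt-descend [ suc i ] ipR sp sn)
    ... | t , child∈ = u , sp , [ suc i ] , t , child∈ , nextpid→freshLeaf (x , i , x∈ , refl)

    -- If x has a fresh leaf child x.a = next_M(π), then x = π: otherwise
    -- the node π = x.prefix(a) would lie inside the edge from x to x.a.
    freshParent→gen : ∀ {x} → FreshParent R x → ∃ λ i → (x , i) ∈ gen M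
    freshParent→gen {x} (u , sp , a , t , a∈ , leaf) with freshLeaf→nextpid leaf
    ... | π , i , π∈ , eq = i , subst (λ z → (z , i) ∈ gen M) (sym x≡π) π∈
      where
      a≢[] : a ≢ []
      a≢[] = child≢[] (SubAt-IsPidTree ipR sp) a∈

      x-prefix≡π : x ++ prefix a ≡ π
      x-prefix≡π = proj₁ (∷ʳ-injective (x ++ prefix a) π
        (trans (++-assoc x (prefix a) [ lastC a ]) (trans (cong (x ++_) (sym (prefix-last a a≢[]))) eq)))

      prefix≡[] : prefix a ≡ []
      prefix≡[] = ¬≢[]⇒≡[] (prefix a) λ prefix≢[] →
        no-node-inside-edge (SubAt-IsPidTree ipR sp) a∈ (prefix-last a a≢[]) prefix≢[] (λ ())
          (SubAt-descend (prefix a) ipR sp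
            (subst (λ z → SubAt N R z (proj₁ π-node)) (sym x-prefix≡π) (proj₂ π-node)))
        where
        π-node : ∃ λ w → SubAt N R π w
        π-node = path-node (proj₁ (gen-rule π i π∈))

      x≡π : x ≡ π
      x≡π = trans (sym (++-identityʳ x)) (trans (cong (x ++_) (sym prefix≡[])) x-prefix≡π)

  restrict-bijection : {h : Pid → Pid → Set} {X Y A B : Pid → Set} → IsBijection N h X Y →
                       (∀ {x} → A x → X x) → (∀ {y} → B y → Y y) →
                       (∀ {x y} → h x y → A x → B y) → (∀ {x y} → h x y → B y → A x) →
                       IsBijection N (restrict N h A) A B
  restrict-bijection (_ , total , functional , injective , surjective) A⊆X B⊆Y forth back =
    (λ { x y (ax , hxy) → ax , forth hxy ax }) ,
    (λ x ax → let (y , hxy) = total x (A⊆X ax) in y , ax , hxy) ,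
    (λ { x y y′ (_ , h₁) (_ , h₂) → functional x y y′ h₁ h₂ }) ,
    (λ { x x′ y (_ , h₁) (_ , h₂) → injective x x′ y h₁ h₂ }) ,
    (λ y by → let (x , hxy) = surjective y (B⊆Y by) in x , back hxy by , hxy)

  module Correspondence {M M′ : Marking N} {R R′ : Tree N} (rep : Repr N M R) (rep′ : Repr N M′ R′)
                        (fresh : Fresh M) (fresh′ : Fresh M′) (eqv : Equiv N R R′) where
    open Transfer R R′ (proj₁ rep) (proj₁ rep′) eqv public
    module C  = Characterisation M R rep fresh
    module C′ = Characterisation M′ R′ rep′ fresh′

    -- Each kind of pid is carried over through its characterising feature.
    pid→ : ∀ {x y} → h x y → pidM N M x → pidM N M′ y
    pid→ hxy (inj₁ (_ , x∈)) = inj₁ (C′.freshParent→gen (freshParent→ hxy (C.gen→freshParent x∈)))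
    pid→ hxy (inj₂ tp)       = inj₂ (C′.referenced→tokenPid (referenced→ hxy (C.tokenPid→referenced tp)))

    pid← : ∀ {x y} → h x y → pidM N M′ y → pidM N M x
    pid← hxy (inj₁ (_ , y∈)) = inj₁ (C.freshParent→gen (freshParent← hxy (C′.gen→freshParent y∈)))
    pid← hxy (inj₂ tp)       = inj₂ (C.referenced→tokenPid (referenced← hxy (C′.tokenPid→referenced tp)))

    next→ : ∀ {x y} → h x y → nextpid N M x → nextpid N M′ y
    next→ hxy nx = C′.freshLeaf→nextpid (freshLeaf→ hxy (C.nextpid→freshLeaf nx))

    next← : ∀ {x y} → h x y → nextpid N M′ y → nextpid N M x
    next← hxy ny = C.freshLeaf→nextpid (freshLeaf← hxy (C′.nextpid→freshLeaf ny))

    used→ : ∀ {x y} → h x y → pidM N M x ⊎ nextpid N M x → pidM N M′ y ⊎ nextpid N M′ y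
    used→ hxy = ⊎-map (pid→ hxy) (next→ hxy)

    used← : ∀ {x y} → h x y → pidM N M′ y ⊎ nextpid N M′ y → pidM N M x ⊎ nextpid N M x
    used← hxy = ⊎-map (pid← hxy) (next← hxy)

proposition2 : {Dd : DataDom} (N : TNet Dd) (M M' : Marking N) →
    Reachable N M → Reachable N M' →
    (R R' : Tree N) → Repr N M R → Repr N M' R' → Equiv N R R' →
      IsBijection N (restrict N (hRel N R R') (pidM N M)) (pidM N M) (pidM N M')
    × IsBijection N (restrict N (hRel N R R') (nextpid N M)) (nextpid N M) (nextpid N M')
    × IsBijection N (restrict N (hRel N R R') (λ ρ → pidM N M ρ ⊎ nextpid N M ρ))
        (λ ρ → pidM N M ρ ⊎ nextpid N M ρ) (λ ρ → pidM N M' ρ ⊎ nextpid N M' ρ)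
proposition2 N M M' reachable reachable′ R R' rep rep′ eqv =
    restrict-bijection N h-bijection C.pid-node  C′.pid-node  pid→  pid← ,
    restrict-bijection N h-bijection C.next-node C′.next-node next→ next← ,
    restrict-bijection N h-bijection C.used-node C′.used-node used→ used←
  where
  open Correspondence N rep rep′ (proj₁ (reachable-invariant N reachable))
                                 (proj₁ (reachable-invariant N reachable′)) eqv
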